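{- Let $g\in\mathcal{P}_n$ with $\deg g\ge 2$. Then \[\sum_{a\in\mathbb{F}_2^n}\Big[\sum_{x\in\mathbb{F}_2^n}(-1)^{g(x+a)+g(x)}\Big]^2\le 2^{2n}+(2^n-1)(2^n-4)^2,\] with equality if and only if $|g+h|=1$ for some $h\in\mathcal{P}_n$ with $\deg h\le 1$.
   Context: $\mathcal{P}_n$ is the set of all functions $\mathbb{F}_2^n\to\mathbb{F}_2$, identified with $\mathbb{F}_2[X_1,\dots,X_n]/\langle X_1^2-X_1,\dots,X_n^2-X_n\rangle$; each function is uniquely a polynomial of degree at most 1 in each variable, and $\deg g$ is the total degree of that polynomial. For $g\in\mathcal{P}_n$, $|g|=|g^{ -1}(1)|$. -}

module Defs where

open import Data.Bool using (Bool; true; false; _xor_; _∧_; if_then_else_; not)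
open import Data.Nat using (ℕ; zero; suc; _⊔_)
open import Data.Integer using (ℤ; _+_; _*_; +_; -_)
open import Data.List using (List; []; _∷_; map; _++_; foldr; filter; length)
open import Data.Vec using (Vec; []; _∷_; zipWith)
open import Relation.Nullary.Decidable using (does)
open import Data.Bool.Properties using (T?)

-- Points of 𝔽₂ⁿ, with 𝔽₂ = Bool (false = 0, true = 1, addition = xor).
Point : ℕ → Set
Point n = Vec Bool n

_⊕_ : ∀ {n} → Point n → Point n → Point n
_⊕_ = zipWith _xor_

allPoints : (n : ℕ) → List (Point n)
allPoints zero = [] ∷ []
allPoints (suc n) = map (false ∷_) (allPoints n) ++ map (true ∷_) (allPoints n)

Fun : ℕ → Set
Fun n = Point n → Bool

-- Multilinear polynomials in X₁..Xₙ over 𝔽₂ (reduced representatives of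
-- 𝔽₂[X]/⟨Xᵢ²-Xᵢ⟩): coefficient of the monomial ∏_{i : uᵢ = 1} Xᵢ, indexed by u ∈ {0,1}ⁿ.
Poly : ℕ → Set
Poly n = Vec Bool n → Bool

monomial : ∀ {n} → Vec Bool n → Point n → Bool
monomial [] [] = true
monomial (false ∷ u) (_ ∷ x) = monomial u x
monomial (true ∷ u) (b ∷ x) = b ∧ monomial u x

eval : ∀ {n} → Poly n → Fun n
eval {n} p x = foldr (λ u acc → (p u ∧ monomial u x) xor acc) false (allPoints n)

wt : ∀ {n} → Vec Bool n → ℕ
wt [] = 0
wt (false ∷ u) = wt u
wt (true ∷ u) = suc (wt u)

-- Total degree of a polynomial: max degree of a monomial with nonzero coefficient
-- (0 for the zero polynomial).
deg : ∀ {n} → Poly n → ℕ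
deg {n} p = foldr (λ u acc → (if p u then wt u else 0) ⊔ acc) 0 (allPoints n)

∣_∣ : ∀ {n} → Fun n → ℕ
∣_∣ {n} g = length (filter (λ x → T? (g x)) (allPoints n))

Σℤ : (n : ℕ) → (Point n → ℤ) → ℤ
Σℤ n f = foldr (λ x acc → f x + acc) (+ 0) (allPoints n)

sgn : Bool → ℤ
sgn false = + 1
sgn true = - (+ 1)

{-# OPTIONS --safe #-}
-- Let N = 2ⁿ, let W(u) = Σₓ (-1)^(g(x) + u·x) be the Walsh coefficients of g and d(u) = |g + u·x|,
-- so that W(u) = N - 2d(u). Plancherel gives Σᵤ W(u)² = N², and since W(u)² is the Walsh transform of
-- the autocorrelation of (-1)^g, also Σᵤ W(u)⁴ = N S, where S is the sum in the statement. As deg g ≥ 2,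
-- g is not affine, so 0 < d(u) < N; and d(u) ≡ |g| (mod 2) because linear forms have even weight.
-- If |g| is odd, then W(u) = 2(N/2 - d(u)) ≠ 0 as N/2 is even, so 4 ≤ W(u)² ≤ (N - 2)², and summing (W² - 4)((N - 2)² - W²) ≥ 0 over u yields
-- N S ≤ N (N² + (N - 1)(N - 4)²). Equality forces W(u)² ∈ {4, (N - 2)²} for all u, and W(u)² = (N - 2)²
-- means d(u) ∈ {1, N - 1}: g is at distance one from u·x or 1 + u·x. Conversely one such u already gives
-- Σ (W² - 4)² ≥ ((N - 2)² - 4)², which is the reverse inequality. If |g| is even, then W(u)² ≤ (N - 4)²,
-- and S ≤ N (N - 4)² is strictly below the bound.

module Submission where

open import Defs
open import Data.Bool using (Bool; true; false; _xor_; _∧_; not; if_then_else_)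
open import Data.Bool.Properties using (T?; ∧-distribˡ-xor; xor-assoc; xor-identityʳ; ∧-identityˡ; ∧-identityʳ; ∧-zeroʳ; not-distribʳ-xor; not-injective)
open import Data.Bool.Solver using (module xor-∧-Solver)
open xor-∧-Solver using (solve; _:=_; _:+_; _:*_)
open import Data.List using (List; []; _∷_; map; _++_; length; filter; foldr)
open import Data.List.Properties using (length-++; length-map; length-filter; filter-++)
open import Data.List.Membership.Propositional using (_∈_; lose)
open import Data.List.Membership.Propositional.Properties using (∈-map⁺; ∈-++⁺ˡ; ∈-++⁺ʳ)
open import Data.List.Relation.Unary.Any using (Any; here; there; any?; satisfied)
open import Data.Nat using (ℕ; zero; suc; _+_; _*_; _^_; _⊔_; _≤_; _<_; z≤n; s≤s; s≤s⁻¹)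
import Data.Nat.Properties as ℕₚ
open import Data.Nat.Divisibility using (_∣_; _∣?_; divides; ∣m+n∣m⇒∣n; ∣m∣n⇒∣m+n; m∣m*n; ∣1⇒≡1)
open import Data.Integer using (ℤ; +_; -_; +[1+_]; -[1+_]; +≤+; +<+; 0ℤ; 1ℤ; -1ℤ; Positive; positive; nonNegative)
  renaming (_+_ to _+ℤ_; _*_ to _*ℤ_; _-_ to _-ℤ_; _≤_ to _≤ℤ_; _<_ to _<ℤ_)
import Data.Integer.Properties as ℤₚ
open import Data.Integer.Tactic.RingSolver using (solve-∀)
open import Data.Vec using (Vec; []; _∷_; replicate)
open import Data.Product using (_×_; _,_; ∃; ∃₂)
open import Data.Sum using (_⊎_; inj₁; inj₂; [_,_]′)
import Data.Sum
open import Function using (_∘_)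
open import Function.Bundles using (_⇔_; mk⇔; Equivalence)
open import Relation.Nullary using (¬_; contradiction; Dec; yes; no)
open import Relation.Binary.PropositionalEquality
open ≡-Reasoning

∑ : {A : Set} → (A → ℤ) → List A → ℤ
∑ f = foldr (λ x acc → f x +ℤ acc) 0ℤ

module _ {A : Set} where

  ∑-cong : ∀ {f g : A → ℤ} xs → (∀ x → f x ≡ g x) → ∑ f xs ≡ ∑ g xs
  ∑-cong []       f≗g = refl
  ∑-cong (x ∷ xs) f≗g = cong₂ _+ℤ_ (f≗g x) (∑-cong xs f≗g)

  ∑-+ : ∀ (f g : A → ℤ) xs → ∑ (λ x → f x +ℤ g x) xs ≡ ∑ f xs +ℤ ∑ g xs
  ∑-+ f g []       = refl
  ∑-+ f g (x ∷ xs) = begin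
    (f x +ℤ g x) +ℤ ∑ (λ x → f x +ℤ g x) xs ≡⟨ cong ((f x +ℤ g x) +ℤ_) (∑-+ f g xs) ⟩
    (f x +ℤ g x) +ℤ (∑ f xs +ℤ ∑ g xs)      ≡⟨ interchange (f x) (g x) (∑ f xs) (∑ g xs) ⟩
    (f x +ℤ ∑ f xs) +ℤ (g x +ℤ ∑ g xs)      ∎
    where
    interchange : ∀ a b c d → (a +ℤ b) +ℤ (c +ℤ d) ≡ (a +ℤ c) +ℤ (b +ℤ d)
    interchange = solve-∀

  ∑-*ˡ : ∀ c (f : A → ℤ) xs → ∑ (λ x → c *ℤ f x) xs ≡ c *ℤ ∑ f xs
  ∑-*ˡ c f []       = sym (ℤₚ.*-zeroʳ c)
  ∑-*ˡ c f (x ∷ xs) = trans (cong (c *ℤ f x +ℤ_) (∑-*ˡ c f xs)) (sym (ℤₚ.*-distribˡ-+ c (f x) (∑ f xs)))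

  ∑-*ʳ : ∀ c (f : A → ℤ) xs → ∑ (λ x → f x *ℤ c) xs ≡ ∑ f xs *ℤ c
  ∑-*ʳ c f xs = begin
    ∑ (λ x → f x *ℤ c) xs ≡⟨ ∑-cong xs (λ x → ℤₚ.*-comm (f x) c) ⟩
    ∑ (λ x → c *ℤ f x) xs ≡⟨ ∑-*ˡ c f xs ⟩
    c *ℤ ∑ f xs           ≡⟨ ℤₚ.*-comm c (∑ f xs) ⟩
    ∑ f xs *ℤ c           ∎

  ∑-++ : ∀ (f : A → ℤ) xs ys → ∑ f (xs ++ ys) ≡ ∑ f xs +ℤ ∑ f ys
  ∑-++ f []       ys = sym (ℤₚ.+-identityˡ (∑ f ys))
  ∑-++ f (x ∷ xs) ys = trans (cong (f x +ℤ_) (∑-++ f xs ys)) (sym (ℤₚ.+-assoc (f x) (∑ f xs) (∑ f ys)))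

  ∑-const : ∀ c (xs : List A) → ∑ (λ _ → c) xs ≡ c *ℤ + length xs
  ∑-const c []       = sym (ℤₚ.*-zeroʳ c)
  ∑-const c (x ∷ xs) = begin
    c +ℤ ∑ (λ _ → c) xs          ≡⟨ cong (c +ℤ_) (∑-const c xs) ⟩
    c +ℤ c *ℤ + length xs        ≡⟨ shift c (+ length xs) ⟩
    c *ℤ (+ 1 +ℤ + length xs)    ≡⟨ cong (c *ℤ_) (ℤₚ.pos-+ 1 (length xs)) ⟨
    c *ℤ + length (x ∷ xs)       ∎
    where
    shift : ∀ c l → c +ℤ c *ℤ l ≡ c *ℤ (+ 1 +ℤ l)
    shift = solve-∀

  ∑-nonNeg : ∀ {f : A → ℤ} xs → (∀ x → 0ℤ ≤ℤ f x) → 0ℤ ≤ℤ ∑ f xs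
  ∑-nonNeg []       0≤f = ℤₚ.≤-refl
  ∑-nonNeg (x ∷ xs) 0≤f = ℤₚ.+-mono-≤ (0≤f x) (∑-nonNeg xs 0≤f)

  ∈⇒≤∑ : ∀ {f : A → ℤ} {xs u} → u ∈ xs → (∀ x → 0ℤ ≤ℤ f x) → f u ≤ℤ ∑ f xs
  ∈⇒≤∑ {f} {x ∷ xs} (here refl) 0≤f = ℤₚ.i≤i+j (f x) (∑ f xs) {{nonNegative (∑-nonNeg xs 0≤f)}}
  ∈⇒≤∑ {f} {x ∷ xs} (there u∈xs) 0≤f = ℤₚ.i≤j⇒i≤k+j (f x) {{nonNegative (0≤f x)}} (∈⇒≤∑ u∈xs 0≤f)

  ∑≡0⇒≡0 : ∀ {f : A → ℤ} {xs u} → u ∈ xs → (∀ x → 0ℤ ≤ℤ f x) → ∑ f xs ≡ 0ℤ → f u ≡ 0ℤ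
  ∑≡0⇒≡0 u∈xs 0≤f ∑≡0 = ℤₚ.≤-antisym (subst (_ ≤ℤ_) ∑≡0 (∈⇒≤∑ u∈xs 0≤f)) (0≤f _)

  ∑-quadratic : ∀ (f : A → ℤ) α β γ xs →
    ∑ (λ x → α *ℤ (f x *ℤ f x) +ℤ β *ℤ f x +ℤ γ) xs
      ≡ α *ℤ ∑ (λ x → f x *ℤ f x) xs +ℤ β *ℤ ∑ f xs +ℤ γ *ℤ + length xs
  ∑-quadratic f α β γ xs = begin
    ∑ (λ x → α *ℤ (f x *ℤ f x) +ℤ β *ℤ f x +ℤ γ) xs
      ≡⟨ ∑-+ (λ x → α *ℤ (f x *ℤ f x) +ℤ β *ℤ f x) (λ _ → γ) xs ⟩
    ∑ (λ x → α *ℤ (f x *ℤ f x) +ℤ β *ℤ f x) xs +ℤ ∑ (λ _ → γ) xs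
      ≡⟨ cong₂ _+ℤ_ (∑-+ (λ x → α *ℤ (f x *ℤ f x)) (λ x → β *ℤ f x) xs) (∑-const γ xs) ⟩
    ∑ (λ x → α *ℤ (f x *ℤ f x)) xs +ℤ ∑ (λ x → β *ℤ f x) xs +ℤ γ *ℤ + length xs
      ≡⟨ cong (_+ℤ γ *ℤ + length xs) (cong₂ _+ℤ_ (∑-*ˡ α (λ x → f x *ℤ f x) xs) (∑-*ˡ β f xs)) ⟩
    α *ℤ ∑ (λ x → f x *ℤ f x) xs +ℤ β *ℤ ∑ f xs +ℤ γ *ℤ + length xs ∎

∑-map : ∀ {A B : Set} (f : B → ℤ) (h : A → B) xs → ∑ f (map h xs) ≡ ∑ (f ∘ h) xs
∑-map f h []       = refl
∑-map f h (x ∷ xs) = cong (f (h x) +ℤ_) (∑-map f h xs)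

∑-swap : ∀ {A B : Set} (f : A → B → ℤ) xs ys →
  ∑ (λ x → ∑ (f x) ys) xs ≡ ∑ (λ y → ∑ (λ x → f x y) xs) ys
∑-swap f []       ys = sym (trans (∑-const 0ℤ ys) (ℤₚ.*-zeroˡ (+ length ys)))
∑-swap f (x ∷ xs) ys = begin
  ∑ (f x) ys +ℤ ∑ (λ x → ∑ (f x) ys) xs            ≡⟨ cong (∑ (f x) ys +ℤ_) (∑-swap f xs ys) ⟩
  ∑ (f x) ys +ℤ ∑ (λ y → ∑ (λ x → f x y) xs) ys    ≡⟨ ∑-+ (f x) (λ y → ∑ (λ x → f x y) xs) ys ⟨
  ∑ (λ y → f x y +ℤ ∑ (λ x → f x y) xs) ys         ∎

∈-allPoints : ∀ {n} (x : Point n) → x ∈ allPoints n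
∈-allPoints []                = here refl
∈-allPoints (false ∷ x)       = ∈-++⁺ˡ (∈-map⁺ (false ∷_) (∈-allPoints x))
∈-allPoints {suc n} (true ∷ x) = ∈-++⁺ʳ (map (false ∷_) (allPoints n)) (∈-map⁺ (true ∷_) (∈-allPoints x))

length-allPoints : ∀ n → length (allPoints n) ≡ 2 ^ n
length-allPoints zero    = refl
length-allPoints (suc n) = begin
  length (map (false ∷_) (allPoints n) ++ map (true ∷_) (allPoints n))
    ≡⟨ length-++ (map (false ∷_) (allPoints n)) ⟩
  length (map (false ∷_) (allPoints n)) + length (map (true ∷_) (allPoints n))
    ≡⟨ cong₂ _+_ (length-map (false ∷_) (allPoints n)) (length-map (true ∷_) (allPoints n)) ⟩
  length (allPoints n) + length (allPoints n)
    ≡⟨ cong₂ _+_ (length-allPoints n) (trans (length-allPoints n) (sym (ℕₚ.+-identityʳ (2 ^ n)))) ⟩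
  2 ^ suc n ∎

Σℤ-∷ : ∀ n (f : Point (suc n) → ℤ) → Σℤ (suc n) f ≡ Σℤ n (f ∘ (false ∷_)) +ℤ Σℤ n (f ∘ (true ∷_))
Σℤ-∷ n f = trans (∑-++ f (map (false ∷_) (allPoints n)) (map (true ∷_) (allPoints n)))
                 (cong₂ _+ℤ_ (∑-map f (false ∷_) (allPoints n)) (∑-map f (true ∷_) (allPoints n)))

Σℤ-translate : ∀ n (x : Point n) (f : Point n → ℤ) → Σℤ n (λ a → f (x ⊕ a)) ≡ Σℤ n f
Σℤ-translate zero    []          f = refl
Σℤ-translate (suc n) (false ∷ x) f = begin
  Σℤ (suc n) (λ a → f ((false ∷ x) ⊕ a))
    ≡⟨ Σℤ-∷ n (λ a → f ((false ∷ x) ⊕ a)) ⟩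
  Σℤ n (λ a → f (false ∷ (x ⊕ a))) +ℤ Σℤ n (λ a → f (true ∷ (x ⊕ a)))
    ≡⟨ cong₂ _+ℤ_ (Σℤ-translate n x (f ∘ (false ∷_))) (Σℤ-translate n x (f ∘ (true ∷_))) ⟩
  Σℤ n (f ∘ (false ∷_)) +ℤ Σℤ n (f ∘ (true ∷_))
    ≡⟨ Σℤ-∷ n f ⟨
  Σℤ (suc n) f ∎
Σℤ-translate (suc n) (true ∷ x)  f = begin
  Σℤ (suc n) (λ a → f ((true ∷ x) ⊕ a))
    ≡⟨ Σℤ-∷ n (λ a → f ((true ∷ x) ⊕ a)) ⟩
  Σℤ n (λ a → f (true ∷ (x ⊕ a))) +ℤ Σℤ n (λ a → f (false ∷ (x ⊕ a)))
    ≡⟨ cong₂ _+ℤ_ (Σℤ-translate n x (f ∘ (true ∷_))) (Σℤ-translate n x (f ∘ (false ∷_))) ⟩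
  Σℤ n (f ∘ (true ∷_)) +ℤ Σℤ n (f ∘ (false ∷_))
    ≡⟨ ℤₚ.+-comm (Σℤ n (f ∘ (true ∷_))) (Σℤ n (f ∘ (false ∷_))) ⟩
  Σℤ n (f ∘ (false ∷_)) +ℤ Σℤ n (f ∘ (true ∷_))
    ≡⟨ Σℤ-∷ n f ⟨
  Σℤ (suc n) f ∎

sgn-xor : ∀ a b → sgn (a xor b) ≡ sgn a *ℤ sgn b
sgn-xor false false = refl
sgn-xor false true  = refl
sgn-xor true  false = refl
sgn-xor true  true  = refl

sgn-not : ∀ a → sgn (not a) ≡ - sgn a
sgn-not false = refl
sgn-not true  = refl

sgn*sgn≡1 : ∀ a → sgn a *ℤ sgn a ≡ 1ℤ
sgn*sgn≡1 false = refl
sgn*sgn≡1 true  = refl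

dot : ∀ {n} → Vec Bool n → Point n → Bool
dot []      []      = false
dot (c ∷ u) (b ∷ x) = (c ∧ b) xor dot u x

dot-⊕ : ∀ {n} (u x y : Point n) → dot u (x ⊕ y) ≡ dot u x xor dot u y
dot-⊕ []      []      []      = refl
dot-⊕ (c ∷ u) (a ∷ x) (b ∷ y) = begin
  (c ∧ (a xor b)) xor dot u (x ⊕ y)               ≡⟨ cong₂ _xor_ (∧-distribˡ-xor c a b) (dot-⊕ u x y) ⟩
  ((c ∧ a) xor (c ∧ b)) xor (dot u x xor dot u y) ≡⟨ xor-interchange (c ∧ a) (c ∧ b) (dot u x) (dot u y) ⟩
  ((c ∧ a) xor dot u x) xor ((c ∧ b) xor dot u y) ∎
  where
  xor-interchange : ∀ a b c d → (a xor b) xor (c xor d) ≡ (a xor c) xor (b xor d)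
  xor-interchange = solve 4 (λ a b c d → (a :+ b) :+ (c :+ d) := (a :+ c) :+ (b :+ d)) refl

xor-moveʳ : ∀ a b c → a xor b ≡ c → a ≡ c xor b
xor-moveʳ a b c a+b≡c = trans (solve 2 (λ a b → a := (a :+ b) :+ b) refl a b) (cong (_xor b) a+b≡c)

χ : ∀ {n} → Vec Bool n → Point n → ℤ
χ u x = sgn (dot u x)

walsh : ∀ {n} → (Point n → ℤ) → Vec Bool n → ℤ
walsh {n} F u = Σℤ n (λ a → F a *ℤ χ u a)

walsh-false∷ : ∀ n F u → walsh {suc n} F (false ∷ u) ≡ walsh (F ∘ (false ∷_)) u +ℤ walsh (F ∘ (true ∷_)) u
walsh-false∷ n F u = Σℤ-∷ n (λ a → F a *ℤ χ (false ∷ u) a)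

walsh-true∷ : ∀ n F u → walsh {suc n} F (true ∷ u) ≡ walsh (F ∘ (false ∷_)) u -ℤ walsh (F ∘ (true ∷_)) u
walsh-true∷ n F u = trans (Σℤ-∷ n (λ a → F a *ℤ χ (true ∷ u) a)) (cong (walsh (F ∘ (false ∷_)) u +ℤ_) (begin
  Σℤ n (λ a → F (true ∷ a) *ℤ sgn (not (dot u a)))
    ≡⟨ ∑-cong (allPoints n) (λ a → begin
         F (true ∷ a) *ℤ sgn (not (dot u a)) ≡⟨ cong (F (true ∷ a) *ℤ_) (sgn-not (dot u a)) ⟩
         F (true ∷ a) *ℤ - χ u a             ≡⟨ ℤₚ.neg-distribʳ-* (F (true ∷ a)) (χ u a) ⟨
         - (F (true ∷ a) *ℤ χ u a)           ≡⟨ ℤₚ.-1*i≡-i (F (true ∷ a) *ℤ χ u a) ⟨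
         -1ℤ *ℤ (F (true ∷ a) *ℤ χ u a)      ∎) ⟩
  Σℤ n (λ a → -1ℤ *ℤ (F (true ∷ a) *ℤ χ u a))
    ≡⟨ ∑-*ˡ -1ℤ (λ a → F (true ∷ a) *ℤ χ u a) (allPoints n) ⟩
  -1ℤ *ℤ walsh (F ∘ (true ∷_)) u
    ≡⟨ ℤₚ.-1*i≡-i (walsh (F ∘ (true ∷_)) u) ⟩
  - walsh (F ∘ (true ∷_)) u ∎))

plancherel : ∀ n (F G : Point n → ℤ) →
  Σℤ n (λ u → walsh F u *ℤ walsh G u) ≡ + (2 ^ n) *ℤ Σℤ n (λ a → F a *ℤ G a)
plancherel zero    F G = base (F []) (G [])
  where
  base : ∀ a b → (a *ℤ 1ℤ +ℤ 0ℤ) *ℤ (b *ℤ 1ℤ +ℤ 0ℤ) +ℤ 0ℤ ≡ 1ℤ *ℤ (a *ℤ b +ℤ 0ℤ)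
  base = solve-∀
plancherel (suc n) F G = begin
  Σℤ (suc n) (λ u → walsh F u *ℤ walsh G u)
    ≡⟨ Σℤ-∷ n (λ u → walsh F u *ℤ walsh G u) ⟩
  Σℤ n (λ u → walsh F (false ∷ u) *ℤ walsh G (false ∷ u)) +ℤ Σℤ n (λ u → walsh F (true ∷ u) *ℤ walsh G (true ∷ u))
    ≡⟨ cong₂ _+ℤ_ (∑-cong (allPoints n) (λ u → cong₂ _*ℤ_ (walsh-false∷ n F u) (walsh-false∷ n G u)))
                  (∑-cong (allPoints n) (λ u → cong₂ _*ℤ_ (walsh-true∷ n F u) (walsh-true∷ n G u))) ⟩
  Σℤ n (λ u → (A u +ℤ B u) *ℤ (C u +ℤ D u)) +ℤ Σℤ n (λ u → (A u -ℤ B u) *ℤ (C u -ℤ D u))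
    ≡⟨ ∑-+ (λ u → (A u +ℤ B u) *ℤ (C u +ℤ D u)) (λ u → (A u -ℤ B u) *ℤ (C u -ℤ D u)) (allPoints n) ⟨
  Σℤ n (λ u → (A u +ℤ B u) *ℤ (C u +ℤ D u) +ℤ (A u -ℤ B u) *ℤ (C u -ℤ D u))
    ≡⟨ ∑-cong (allPoints n) (λ u → polarise (A u) (B u) (C u) (D u)) ⟩
  Σℤ n (λ u → + 2 *ℤ (A u *ℤ C u +ℤ B u *ℤ D u))
    ≡⟨ ∑-*ˡ (+ 2) (λ u → A u *ℤ C u +ℤ B u *ℤ D u) (allPoints n) ⟩
  + 2 *ℤ Σℤ n (λ u → A u *ℤ C u +ℤ B u *ℤ D u)
    ≡⟨ cong (+ 2 *ℤ_) (∑-+ (λ u → A u *ℤ C u) (λ u → B u *ℤ D u) (allPoints n)) ⟩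
  + 2 *ℤ (Σℤ n (λ u → A u *ℤ C u) +ℤ Σℤ n (λ u → B u *ℤ D u))
    ≡⟨ cong (+ 2 *ℤ_) (cong₂ _+ℤ_ (plancherel n F₀ G₀) (plancherel n F₁ G₁)) ⟩
  + 2 *ℤ (+ (2 ^ n) *ℤ Σℤ n (λ a → F₀ a *ℤ G₀ a) +ℤ + (2 ^ n) *ℤ Σℤ n (λ a → F₁ a *ℤ G₁ a))
    ≡⟨ factor (+ (2 ^ n)) (Σℤ n (λ a → F₀ a *ℤ G₀ a)) (Σℤ n (λ a → F₁ a *ℤ G₁ a)) ⟩
  + 2 *ℤ + (2 ^ n) *ℤ (Σℤ n (λ a → F₀ a *ℤ G₀ a) +ℤ Σℤ n (λ a → F₁ a *ℤ G₁ a))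
    ≡⟨ cong₂ _*ℤ_ (ℤₚ.pos-* 2 (2 ^ n)) (Σℤ-∷ n (λ a → F a *ℤ G a)) ⟨
  + (2 ^ suc n) *ℤ Σℤ (suc n) (λ a → F a *ℤ G a) ∎
  where
  F₀ F₁ G₀ G₁ : Point n → ℤ
  F₀ = F ∘ (false ∷_)
  F₁ = F ∘ (true ∷_)
  G₀ = G ∘ (false ∷_)
  G₁ = G ∘ (true ∷_)
  A B C D : Point n → ℤ
  A = walsh F₀
  B = walsh F₁
  C = walsh G₀
  D = walsh G₁
  polarise : ∀ a b c d → (a +ℤ b) *ℤ (c +ℤ d) +ℤ (a -ℤ b) *ℤ (c -ℤ d) ≡ + 2 *ℤ (a *ℤ c +ℤ b *ℤ d)
  polarise = solve-∀
  factor : ∀ p x y → + 2 *ℤ (p *ℤ x +ℤ p *ℤ y) ≡ + 2 *ℤ p *ℤ (x +ℤ y)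
  factor = solve-∀

autocorrelation : ∀ {n} → (Point n → ℤ) → Point n → ℤ
autocorrelation {n} F a = Σℤ n (λ x → F (x ⊕ a) *ℤ F x)

walsh²≡walsh-autocorrelation : ∀ n (F : Point n → ℤ) u →
  walsh F u *ℤ walsh F u ≡ walsh (autocorrelation F) u
walsh²≡walsh-autocorrelation n F u = begin
  walsh F u *ℤ walsh F u
    ≡⟨ ∑-*ʳ (walsh F u) (λ x → F x *ℤ χ u x) (allPoints n) ⟨
  Σℤ n (λ x → (F x *ℤ χ u x) *ℤ walsh F u)
    ≡⟨ ∑-cong (allPoints n) (λ x → ∑-*ˡ (F x *ℤ χ u x) (λ y → F y *ℤ χ u y) (allPoints n)) ⟨
  Σℤ n (λ x → Σℤ n (λ y → (F x *ℤ χ u x) *ℤ (F y *ℤ χ u y)))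
    ≡⟨ ∑-cong (allPoints n) (λ x → Σℤ-translate n x (λ y → (F x *ℤ χ u x) *ℤ (F y *ℤ χ u y))) ⟨
  Σℤ n (λ x → Σℤ n (λ a → (F x *ℤ χ u x) *ℤ (F (x ⊕ a) *ℤ χ u (x ⊕ a))))
    ≡⟨ ∑-cong (allPoints n) (λ x → ∑-cong (allPoints n) (λ a → character-cancels x a)) ⟩
  Σℤ n (λ x → Σℤ n (λ a → (F (x ⊕ a) *ℤ F x) *ℤ χ u a))
    ≡⟨ ∑-swap (λ x a → (F (x ⊕ a) *ℤ F x) *ℤ χ u a) (allPoints n) (allPoints n) ⟩
  Σℤ n (λ a → Σℤ n (λ x → (F (x ⊕ a) *ℤ F x) *ℤ χ u a))
    ≡⟨ ∑-cong (allPoints n) (λ a → ∑-*ʳ (χ u a) (λ x → F (x ⊕ a) *ℤ F x) (allPoints n)) ⟩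
  walsh (autocorrelation F) u ∎
  where
  character-cancels : ∀ x a → (F x *ℤ χ u x) *ℤ (F (x ⊕ a) *ℤ χ u (x ⊕ a)) ≡ (F (x ⊕ a) *ℤ F x) *ℤ χ u a
  character-cancels x a = begin
    (F x *ℤ χ u x) *ℤ (F (x ⊕ a) *ℤ χ u (x ⊕ a))
      ≡⟨ cong (λ t → (F x *ℤ χ u x) *ℤ (F (x ⊕ a) *ℤ sgn t)) (dot-⊕ u x a) ⟩
    (F x *ℤ χ u x) *ℤ (F (x ⊕ a) *ℤ sgn (dot u x xor dot u a))
      ≡⟨ cong (λ t → (F x *ℤ χ u x) *ℤ (F (x ⊕ a) *ℤ t)) (sgn-xor (dot u x) (dot u a)) ⟩
    (F x *ℤ χ u x) *ℤ (F (x ⊕ a) *ℤ (χ u x *ℤ χ u a))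
      ≡⟨ regroup (F x) (χ u x) (F (x ⊕ a)) (χ u a) ⟩
    (F (x ⊕ a) *ℤ F x) *ℤ χ u a *ℤ (χ u x *ℤ χ u x)
      ≡⟨ cong ((F (x ⊕ a) *ℤ F x) *ℤ χ u a *ℤ_) (sgn*sgn≡1 (dot u x)) ⟩
    (F (x ⊕ a) *ℤ F x) *ℤ χ u a *ℤ 1ℤ
      ≡⟨ ℤₚ.*-identityʳ _ ⟩
    (F (x ⊕ a) *ℤ F x) *ℤ χ u a ∎
    where
    regroup : ∀ p c q e → (p *ℤ c) *ℤ (q *ℤ (c *ℤ e)) ≡ (q *ℤ p) *ℤ e *ℤ (c *ℤ c)
    regroup = solve-∀

count : {A : Set} → (A → Bool) → List A → ℕ
count φ xs = length (filter (λ x → T? (φ x)) xs)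

module _ {A : Set} where

  count-∷ : ∀ (φ : A → Bool) x xs → count φ (x ∷ xs) ≡ (if φ x then 1 else 0) + count φ xs
  count-∷ φ x xs with φ x
  ... | true  = refl
  ... | false = refl

  count-cong : ∀ {φ ψ : A → Bool} xs → (∀ x → φ x ≡ ψ x) → count φ xs ≡ count ψ xs
  count-cong []       φ≗ψ = refl
  count-cong {φ} {ψ} (x ∷ xs) φ≗ψ = begin
    count φ (x ∷ xs)                         ≡⟨ count-∷ φ x xs ⟩
    (if φ x then 1 else 0) + count φ xs      ≡⟨ cong₂ (λ b c → (if b then 1 else 0) + c) (φ≗ψ x) (count-cong xs φ≗ψ) ⟩
    (if ψ x then 1 else 0) + count ψ xs      ≡⟨ count-∷ ψ x xs ⟨
    count ψ (x ∷ xs)                         ∎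

  count-≤-length : ∀ (φ : A → Bool) xs → count φ xs ≤ length xs
  count-≤-length φ = length-filter (λ x → T? (φ x))

  count-not : ∀ (φ : A → Bool) xs → count (not ∘ φ) xs + count φ xs ≡ length xs
  count-not φ []       = refl
  count-not φ (x ∷ xs) with φ x
  ... | true  = trans (ℕₚ.+-suc _ _) (cong suc (count-not φ xs))
  ... | false = cong suc (count-not φ xs)

  count≡0⇒false : ∀ {φ : A → Bool} {xs x} → x ∈ xs → count φ xs ≡ 0 → φ x ≡ false
  count≡0⇒false {φ} {y ∷ xs} x∈ c≡0 with φ y in φy
  count≡0⇒false {φ} {y ∷ xs} x∈ () | true
  count≡0⇒false {φ} {y ∷ xs} (here refl) c≡0 | false = φy
  count≡0⇒false {φ} {y ∷ xs} (there x∈) c≡0 | false = count≡0⇒false x∈ c≡0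

  count-xor : ∀ (φ ψ : A → Bool) xs →
    count (λ x → φ x xor ψ x) xs + 2 * count (λ x → φ x ∧ ψ x) xs ≡ count φ xs + count ψ xs
  count-xor φ ψ []       = refl
  count-xor φ ψ (x ∷ xs) = begin
    count (λ x → φ x xor ψ x) (x ∷ xs) + 2 * count (λ x → φ x ∧ ψ x) (x ∷ xs)
      ≡⟨ cong₂ (λ c c′ → c + 2 * c′) (count-∷ (λ x → φ x xor ψ x) x xs) (count-∷ (λ x → φ x ∧ ψ x) x xs) ⟩
    (⟦ φ x xor ψ x ⟧ + X) + 2 * (⟦ φ x ∧ ψ x ⟧ + Y)
      ≡⟨ step (φ x) (ψ x) ⟩
    (⟦ φ x ⟧ + count φ xs) + (⟦ ψ x ⟧ + count ψ xs)
      ≡⟨ cong₂ _+_ (count-∷ φ x xs) (count-∷ ψ x xs) ⟨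
    count φ (x ∷ xs) + count ψ (x ∷ xs) ∎
    where
    ⟦_⟧ : Bool → ℕ
    ⟦ b ⟧ = if b then 1 else 0
    X Y : ℕ
    X = count (λ x → φ x xor ψ x) xs
    Y = count (λ x → φ x ∧ ψ x) xs
    ih : X + 2 * Y ≡ count φ xs + count ψ xs
    ih = count-xor φ ψ xs
    step : ∀ a b → (⟦ a xor b ⟧ + X) + 2 * (⟦ a ∧ b ⟧ + Y) ≡ (⟦ a ⟧ + count φ xs) + (⟦ b ⟧ + count ψ xs)
    step false false = ih
    step false true  = trans (cong suc ih) (sym (ℕₚ.+-suc (count φ xs) (count ψ xs)))
    step true  false = cong suc ih
    step true  true  = begin
      X + 2 * suc Y          ≡⟨ cong (λ t → X + t) (ℕₚ.*-suc 2 Y) ⟩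
      X + (2 + 2 * Y)        ≡⟨ ℕₚ.+-comm X (2 + 2 * Y) ⟩
      2 + (2 * Y + X)        ≡⟨ cong (λ t → 2 + t) (ℕₚ.+-comm (2 * Y) X) ⟩
      2 + (X + 2 * Y)        ≡⟨ cong (λ t → 2 + t) ih ⟩
      2 + (count φ xs + count ψ xs) ≡⟨ cong suc (ℕₚ.+-suc (count φ xs) (count ψ xs)) ⟨
      suc (count φ xs) + suc (count ψ xs) ∎

  count-++ : ∀ (φ : A → Bool) xs ys → count φ (xs ++ ys) ≡ count φ xs + count φ ys
  count-++ φ xs ys = trans (cong length (filter-++ (λ x → T? (φ x)) xs ys)) (length-++ (filter (λ x → T? (φ x)) xs))

  ∑-sgn : ∀ (φ : A → Bool) xs → ∑ (sgn ∘ φ) xs ≡ + length xs -ℤ + 2 *ℤ + count φ xs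
  ∑-sgn φ []       = refl
  ∑-sgn φ (x ∷ xs) with φ x
  ... | true  = begin
    -1ℤ +ℤ ∑ (sgn ∘ φ) xs                                ≡⟨ cong (-1ℤ +ℤ_) (∑-sgn φ xs) ⟩
    -1ℤ +ℤ (+ length xs -ℤ + 2 *ℤ + count φ xs)          ≡⟨ step (+ length xs) (+ count φ xs) ⟩
    (1ℤ +ℤ + length xs) -ℤ + 2 *ℤ (1ℤ +ℤ + count φ xs)   ≡⟨ cong₂ (λ l c → l -ℤ + 2 *ℤ c) (ℤₚ.pos-+ 1 (length xs)) (ℤₚ.pos-+ 1 (count φ xs)) ⟨
    + suc (length xs) -ℤ + 2 *ℤ + suc (count φ xs)       ∎
    where
    step : ∀ l c → -1ℤ +ℤ (l -ℤ + 2 *ℤ c) ≡ (1ℤ +ℤ l) -ℤ + 2 *ℤ (1ℤ +ℤ c)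
    step = solve-∀
  ... | false = begin
    1ℤ +ℤ ∑ (sgn ∘ φ) xs                                 ≡⟨ cong (1ℤ +ℤ_) (∑-sgn φ xs) ⟩
    1ℤ +ℤ (+ length xs -ℤ + 2 *ℤ + count φ xs)           ≡⟨ step (+ length xs) (+ count φ xs) ⟩
    (1ℤ +ℤ + length xs) -ℤ + 2 *ℤ + count φ xs           ≡⟨ cong (λ l → l -ℤ + 2 *ℤ + count φ xs) (ℤₚ.pos-+ 1 (length xs)) ⟨
    + suc (length xs) -ℤ + 2 *ℤ + count φ xs             ∎
    where
    step : ∀ l c → 1ℤ +ℤ (l -ℤ + 2 *ℤ c) ≡ (1ℤ +ℤ l) -ℤ + 2 *ℤ c
    step = solve-∀

  2∣count-xor⇔ : ∀ (φ ψ : A → Bool) xs → (2 ∣ count ψ xs) →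
    (2 ∣ count (λ x → φ x xor ψ x) xs) ⇔ (2 ∣ count φ xs)
  2∣count-xor⇔ φ ψ xs 2∣ψ = mk⇔
    (λ 2∣X → ∣m+n∣m⇒∣n (subst (2 ∣_) (trans (count-xor φ ψ xs) (ℕₚ.+-comm (count φ xs) (count ψ xs)))
                                     (∣m∣n⇒∣m+n 2∣X (m∣m*n Y)))
                        2∣ψ)
    (λ 2∣φ → ∣m+n∣m⇒∣n (subst (2 ∣_) (trans (sym (count-xor φ ψ xs)) (ℕₚ.+-comm X (2 * Y)))
                                     (∣m∣n⇒∣m+n 2∣φ 2∣ψ))
                        (m∣m*n Y))
    where
    X Y : ℕ
    X = count (λ x → φ x xor ψ x) xs
    Y = count (λ x → φ x ∧ ψ x) xs

count-map : ∀ {A B : Set} (φ : B → Bool) (h : A → B) xs → count φ (map h xs) ≡ count (φ ∘ h) xs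
count-map φ h []       = refl
count-map φ h (x ∷ xs) with φ (h x)
... | true  = cong suc (count-map φ h xs)
... | false = count-map φ h xs

∣∣-∷ : ∀ n (φ : Fun (suc n)) → ∣ φ ∣ ≡ ∣ φ ∘ (false ∷_) ∣ + ∣ φ ∘ (true ∷_) ∣
∣∣-∷ n φ = trans (count-++ φ (map (false ∷_) (allPoints n)) (map (true ∷_) (allPoints n)))
                 (cong₂ _+_ (count-map φ (false ∷_) (allPoints n)) (count-map φ (true ∷_) (allPoints n)))

∣not∣+∣∣ : ∀ n (φ : Fun n) → ∣ not ∘ φ ∣ + ∣ φ ∣ ≡ 2 ^ n
∣not∣+∣∣ n φ = trans (count-not φ (allPoints n)) (length-allPoints n)

-- For n = 1 the form x₁ has odd weight.
2∣∣dot∣ : ∀ n (u : Vec Bool (2 + n)) → 2 ∣ (∣ dot u ∣)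
2∣∣dot∣ n (false ∷ u) = divides ∣ dot u ∣ (begin
  ∣ dot (false ∷ u) ∣                  ≡⟨ ∣∣-∷ (suc n) (dot (false ∷ u)) ⟩
  ∣ dot u ∣ + ∣ dot u ∣                ≡⟨ cong (λ t → ∣ dot u ∣ + t) (ℕₚ.+-identityʳ ∣ dot u ∣) ⟨
  2 * ∣ dot u ∣                        ≡⟨ ℕₚ.*-comm 2 ∣ dot u ∣ ⟩
  ∣ dot u ∣ * 2                        ∎)
2∣∣dot∣ n (true ∷ u)  = divides (2 ^ n) (begin
  ∣ dot (true ∷ u) ∣                   ≡⟨ ∣∣-∷ (suc n) (dot (true ∷ u)) ⟩
  ∣ dot u ∣ + ∣ not ∘ dot u ∣          ≡⟨ ℕₚ.+-comm ∣ dot u ∣ ∣ not ∘ dot u ∣ ⟩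
  ∣ not ∘ dot u ∣ + ∣ dot u ∣          ≡⟨ ∣not∣+∣∣ (suc n) (dot u) ⟩
  2 ^ suc n                            ≡⟨ ℕₚ.*-comm 2 (2 ^ n) ⟩
  2 ^ n * 2                            ∎)

⨁ : {A : Set} → (A → Bool) → List A → Bool
⨁ ψ = foldr (λ x acc → ψ x xor acc) false

module _ {A : Set} where

  ⨁-cong : ∀ {ψ φ : A → Bool} xs → (∀ x → ψ x ≡ φ x) → ⨁ ψ xs ≡ ⨁ φ xs
  ⨁-cong []       ψ≗φ = refl
  ⨁-cong (x ∷ xs) ψ≗φ = cong₂ _xor_ (ψ≗φ x) (⨁-cong xs ψ≗φ)

  ⨁-++ : ∀ (ψ : A → Bool) xs ys → ⨁ ψ (xs ++ ys) ≡ ⨁ ψ xs xor ⨁ ψ ys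
  ⨁-++ ψ []       ys = refl
  ⨁-++ ψ (x ∷ xs) ys = trans (cong (ψ x xor_) (⨁-++ ψ xs ys)) (sym (xor-assoc (ψ x) (⨁ ψ xs) (⨁ ψ ys)))

  ⨁-∧ˡ : ∀ b (ψ : A → Bool) xs → ⨁ (λ x → b ∧ ψ x) xs ≡ b ∧ ⨁ ψ xs
  ⨁-∧ˡ false ψ []       = refl
  ⨁-∧ˡ true  ψ []       = refl
  ⨁-∧ˡ false ψ (x ∷ xs) = ⨁-∧ˡ false ψ xs
  ⨁-∧ˡ true  ψ (x ∷ xs) = refl

⨁-map : ∀ {A B : Set} (ψ : B → Bool) (h : A → B) xs → ⨁ ψ (map h xs) ≡ ⨁ (ψ ∘ h) xs
⨁-map ψ h []       = refl
⨁-map ψ h (x ∷ xs) = cong (ψ (h x) xor_) (⨁-map ψ h xs)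

eval-[] : (p : Poly 0) → eval p [] ≡ p []
eval-[] p = trans (xor-identityʳ (p [] ∧ true)) (∧-identityʳ (p []))

eval-∷ : ∀ {n} (p : Poly (suc n)) b x →
  eval p (b ∷ x) ≡ eval (p ∘ (false ∷_)) x xor (b ∧ eval (p ∘ (true ∷_)) x)
eval-∷ {n} p b x = begin
  eval p (b ∷ x)
    ≡⟨ ⨁-++ term (map (false ∷_) (allPoints n)) (map (true ∷_) (allPoints n)) ⟩
  ⨁ term (map (false ∷_) (allPoints n)) xor ⨁ term (map (true ∷_) (allPoints n))
    ≡⟨ cong₂ _xor_ (⨁-map term (false ∷_) (allPoints n)) (⨁-map term (true ∷_) (allPoints n)) ⟩
  eval (p ∘ (false ∷_)) x xor ⨁ (λ u → p (true ∷ u) ∧ (b ∧ monomial u x)) (allPoints n)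
    ≡⟨ cong (eval (p ∘ (false ∷_)) x xor_) (begin
         ⨁ (λ u → p (true ∷ u) ∧ (b ∧ monomial u x)) (allPoints n)
           ≡⟨ ⨁-cong (allPoints n) (λ u → ∧-swap (p (true ∷ u)) b (monomial u x)) ⟩
         ⨁ (λ u → b ∧ (p (true ∷ u) ∧ monomial u x)) (allPoints n)
           ≡⟨ ⨁-∧ˡ b (λ u → p (true ∷ u) ∧ monomial u x) (allPoints n) ⟩
         b ∧ eval (p ∘ (true ∷_)) x ∎) ⟩
  eval (p ∘ (false ∷_)) x xor (b ∧ eval (p ∘ (true ∷_)) x) ∎
  where
  term : Vec Bool (suc n) → Bool
  term u = p u ∧ monomial u (b ∷ x)
  ∧-swap : ∀ a b c → a ∧ (b ∧ c) ≡ b ∧ (a ∧ c)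
  ∧-swap = solve 3 (λ a b c → a :* (b :* c) := b :* (a :* c)) refl

eval-false∷ : ∀ {n} (p : Poly (suc n)) x → eval p (false ∷ x) ≡ eval (p ∘ (false ∷_)) x
eval-false∷ p x = trans (eval-∷ p false x) (xor-identityʳ _)

eval-true∷ : ∀ {n} (p : Poly (suc n)) x → eval (p ∘ (true ∷_)) x ≡ eval p (false ∷ x) xor eval p (true ∷ x)
eval-true∷ p x = begin
  eval p₁ x                                   ≡⟨ cancel (eval p₀ x) (eval p₁ x) ⟩
  eval p₀ x xor (eval p₀ x xor eval p₁ x)     ≡⟨ cong₂ (λ s t → s xor (eval p₀ x xor t)) (eval-false∷ p x) (∧-identityˡ (eval p₁ x)) ⟨
  eval p (false ∷ x) xor (eval p₀ x xor (true ∧ eval p₁ x)) ≡⟨ cong (eval p (false ∷ x) xor_) (eval-∷ p true x) ⟨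
  eval p (false ∷ x) xor eval p (true ∷ x)    ∎
  where
  p₀ = p ∘ (false ∷_)
  p₁ = p ∘ (true ∷_)
  cancel : ∀ a b → b ≡ a xor (a xor b)
  cancel = solve 2 (λ a b → b := a :+ (a :+ b)) refl

eval-injective : ∀ {n} (p q : Poly n) → (∀ x → eval p x ≡ eval q x) → ∀ v → p v ≡ q v
eval-injective p q p≗q [] = trans (sym (eval-[] p)) (trans (p≗q []) (eval-[] q))
eval-injective p q p≗q (false ∷ v) = eval-injective (p ∘ (false ∷_)) (q ∘ (false ∷_))
  (λ x → trans (sym (eval-false∷ p x)) (trans (p≗q (false ∷ x)) (eval-false∷ q x))) v
eval-injective p q p≗q (true ∷ v) = eval-injective (p ∘ (true ∷_)) (q ∘ (true ∷_))
  (λ x → trans (eval-true∷ p x) (trans (cong₂ _xor_ (p≗q (false ∷ x)) (p≗q (true ∷ x))) (sym (eval-true∷ q x)))) v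

eval-cong : ∀ {n} {p q : Poly n} → (∀ v → p v ≡ q v) → ∀ x → eval p x ≡ eval q x
eval-cong {n} p≗q x = ⨁-cong (allPoints n) (λ u → cong (_∧ monomial u x) (p≗q u))

⨆ : {A : Set} → (A → ℕ) → List A → ℕ
⨆ f = foldr (λ x acc → f x ⊔ acc) 0

module _ {A : Set} where

  ⨆-lub : ∀ {f : A → ℕ} {k} xs → (∀ x → f x ≤ k) → ⨆ f xs ≤ k
  ⨆-lub []       f≤k = z≤n
  ⨆-lub (x ∷ xs) f≤k = ℕₚ.⊔-lub (f≤k x) (⨆-lub xs f≤k)

  ≤-⨆ : ∀ {f : A → ℕ} {xs x} → x ∈ xs → f x ≤ ⨆ f xs
  ≤-⨆ {f} {y ∷ xs} (here refl) = ℕₚ.m≤m⊔n (f y) (⨆ f xs)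
  ≤-⨆ {f} {y ∷ xs} (there x∈) = ℕₚ.≤-trans (≤-⨆ x∈) (ℕₚ.m≤n⊔m (f y) (⨆ f xs))

deg-≤ : ∀ {n} (p : Poly n) {k} → (∀ v → p v ≡ true → wt v ≤ k) → deg p ≤ k
deg-≤ {n} p {k} wt≤k = ⨆-lub (allPoints n) term≤k
  where
  term≤k : ∀ v → (if p v then wt v else 0) ≤ k
  term≤k v with p v in pv
  ... | true  = wt≤k v pv
  ... | false = z≤n

deg≤⇒wt≤ : ∀ {n} (p : Poly n) {k} → deg p ≤ k → ∀ v → p v ≡ true → wt v ≤ k
deg≤⇒wt≤ {n} p deg≤k v pv = ℕₚ.≤-trans (subst (λ b → (if b then wt v else 0) ≤ deg p) pv
                                                (≤-⨆ {f = λ u → if p u then wt u else 0} (∈-allPoints v)))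
                                         deg≤k

wt≤length : ∀ {n} (v : Vec Bool n) → wt v ≤ n
wt≤length []          = z≤n
wt≤length (false ∷ v) = ℕₚ.m≤n⇒m≤1+n (wt≤length v)
wt≤length (true ∷ v)  = s≤s (wt≤length v)

deg≤n : ∀ {n} (p : Poly n) → deg p ≤ n
deg≤n p = deg-≤ p (λ v _ → wt≤length v)

zeros : ∀ n → Point n
zeros n = replicate n false

constPoly : ∀ {n} → Bool → Poly n
constPoly c []          = c
constPoly c (false ∷ v) = constPoly c v
constPoly c (true ∷ v)  = false

affinePoly : ∀ {n} → Vec Bool n → Bool → Poly n
affinePoly []      c []          = c
affinePoly (b ∷ u) c (false ∷ v) = affinePoly u c v
affinePoly (b ∷ u) c (true ∷ v)  = constPoly b v

linearPart : ∀ {n} → Poly n → Vec Bool n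
linearPart {zero}  p = []
linearPart {suc n} p = p (true ∷ zeros n) ∷ linearPart (p ∘ (false ∷_))

⨁-false : ∀ {A : Set} (xs : List A) → ⨁ (λ _ → false) xs ≡ false
⨁-false []       = refl
⨁-false (x ∷ xs) = ⨁-false xs

eval-constPoly : ∀ {n} c (x : Point n) → eval (constPoly c) x ≡ c
eval-constPoly c []      = eval-[] (constPoly c)
eval-constPoly {suc n} c (y ∷ x) = begin
  eval (constPoly c) (y ∷ x)                            ≡⟨ eval-∷ (constPoly c) y x ⟩
  eval (constPoly c) x xor (y ∧ ⨁ (λ _ → false) (allPoints n)) ≡⟨ cong₂ (λ s t → s xor (y ∧ t)) (eval-constPoly c x) (⨁-false (allPoints n)) ⟩
  c xor (y ∧ false)                                     ≡⟨ cong (c xor_) (∧-zeroʳ y) ⟩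
  c xor false                                           ≡⟨ xor-identityʳ c ⟩
  c                                                     ∎

eval-affinePoly : ∀ {n} (u : Vec Bool n) c x → eval (affinePoly u c) x ≡ c xor dot u x
eval-affinePoly []      c []      = trans (eval-[] (affinePoly [] c)) (sym (xor-identityʳ c))
eval-affinePoly (b ∷ u) c (y ∷ x) = begin
  eval (affinePoly (b ∷ u) c) (y ∷ x)                 ≡⟨ eval-∷ (affinePoly (b ∷ u) c) y x ⟩
  eval (affinePoly u c) x xor (y ∧ eval (constPoly b) x) ≡⟨ cong₂ (λ s t → s xor (y ∧ t)) (eval-affinePoly u c x) (eval-constPoly b x) ⟩
  (c xor dot u x) xor (y ∧ b)                          ≡⟨ rearrange c (dot u x) b y ⟩
  c xor ((b ∧ y) xor dot u x)                          ∎
  where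
  rearrange : ∀ c t b y → (c xor t) xor (y ∧ b) ≡ c xor ((b ∧ y) xor t)
  rearrange = solve 4 (λ c t b y → (c :+ t) :+ (y :* b) := c :+ ((b :* y) :+ t)) refl

constPoly-wt : ∀ {n} c (v : Vec Bool n) → constPoly c v ≡ true → wt v ≡ 0
constPoly-wt c []          _ = refl
constPoly-wt c (false ∷ v) e = constPoly-wt c v e

affinePoly-wt : ∀ {n} (u : Vec Bool n) c v → affinePoly u c v ≡ true → wt v ≤ 1
affinePoly-wt []      c []          _ = z≤n
affinePoly-wt (b ∷ u) c (false ∷ v) e = affinePoly-wt u c v e
affinePoly-wt (b ∷ u) c (true ∷ v)  e = s≤s (ℕₚ.≤-reflexive (constPoly-wt b v e))

wt≡0⇒≡constPoly : ∀ {n} (p : Poly n) → (∀ v → p v ≡ true → wt v ≡ 0) → ∀ v → p v ≡ constPoly (p (zeros n)) v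
wt≡0⇒≡constPoly p wt≡0 []          = refl
wt≡0⇒≡constPoly p wt≡0 (false ∷ v) = wt≡0⇒≡constPoly (p ∘ (false ∷_)) (wt≡0 ∘ (false ∷_)) v
wt≡0⇒≡constPoly p wt≡0 (true ∷ v) with p (true ∷ v) in pv
... | false = refl
... | true  = contradiction (wt≡0 (true ∷ v) pv) λ ()

wt≤1⇒≡affinePoly : ∀ {n} (p : Poly n) → (∀ v → p v ≡ true → wt v ≤ 1) →
  ∀ v → p v ≡ affinePoly (linearPart p) (p (zeros n)) v
wt≤1⇒≡affinePoly p wt≤1 []          = refl
wt≤1⇒≡affinePoly p wt≤1 (false ∷ v) = wt≤1⇒≡affinePoly (p ∘ (false ∷_)) (wt≤1 ∘ (false ∷_)) v
wt≤1⇒≡affinePoly p wt≤1 (true ∷ v)  =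
  wt≡0⇒≡constPoly (p ∘ (true ∷_)) (λ v pv → ℕₚ.n≤0⇒n≡0 (s≤s⁻¹ (wt≤1 (true ∷ v) pv))) v

deg≤1⇒affine : ∀ {n} (p : Poly n) → deg p ≤ 1 → ∃₂ λ u c → ∀ x → eval p x ≡ c xor dot u x
deg≤1⇒affine {n} p deg≤1 = linearPart p , p (zeros n) , λ x →
  trans (eval-cong (wt≤1⇒≡affinePoly p (deg≤⇒wt≤ p deg≤1)) x) (eval-affinePoly (linearPart p) (p (zeros n)) x)

affine⇒deg≤1 : ∀ {n} (p : Poly n) u c → (∀ x → eval p x ≡ c xor dot u x) → deg p ≤ 1
affine⇒deg≤1 p u c p≗affine = deg-≤ p λ v pv →
  affinePoly-wt u c v (trans (sym (p≡affinePoly v)) pv)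
  where
  p≡affinePoly : ∀ v → p v ≡ affinePoly u c v
  p≡affinePoly = eval-injective p (affinePoly u c) (λ x → trans (p≗affine x) (sym (eval-affinePoly u c x)))

deg-affinePoly : ∀ {n} (u : Vec Bool n) c → deg (affinePoly u c) ≤ 1
deg-affinePoly u c = deg-≤ (affinePoly u c) (affinePoly-wt u c)

even<even⇒2+≤ : ∀ {m n} → 2 ∣ m → 2 ∣ n → m < n → 2 + m ≤ n
even<even⇒2+≤ (divides p refl) (divides q refl) pm<qm = ℕₚ.*-monoˡ-≤ 2 (ℕₚ.*-cancelʳ-< 2 p q pm<qm)

0≤i*j : ∀ {i j} → 0ℤ ≤ℤ i → 0ℤ ≤ℤ j → 0ℤ ≤ℤ i *ℤ j
0≤i*j {+ m} {+ n} _ _ = subst (0ℤ ≤ℤ_) (ℤₚ.pos-* m n) (+≤+ z≤n)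

0≤i*i : ∀ i → 0ℤ ≤ℤ i *ℤ i
0≤i*i (+ zero) = +≤+ z≤n
0≤i*i +[1+ k ] = +≤+ z≤n
0≤i*i -[1+ k ] = +≤+ z≤n

1≤i*i : ∀ i → i ≢ 0ℤ → 1ℤ ≤ℤ i *ℤ i
1≤i*i (+ zero)  i≢0 = contradiction refl i≢0
1≤i*i +[1+ k ]  _   = +≤+ (s≤s z≤n)
1≤i*i -[1+ k ]  _   = +≤+ (s≤s z≤n)

module _ (N d : ℕ) where

  private
    w : ℤ
    w = + N -ℤ + 2 *ℤ + d

  [N-2]²-[N-2d]² : (+ N -ℤ + 2) *ℤ (+ N -ℤ + 2) -ℤ w *ℤ w ≡ + 4 *ℤ ((+ d -ℤ 1ℤ) *ℤ (+ N -ℤ (1ℤ +ℤ + d)))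
  [N-2]²-[N-2d]² = factor (+ N) (+ d)
    where
    factor : ∀ N d → (N -ℤ + 2) *ℤ (N -ℤ + 2) -ℤ (N -ℤ + 2 *ℤ d) *ℤ (N -ℤ + 2 *ℤ d)
                       ≡ + 4 *ℤ ((d -ℤ 1ℤ) *ℤ (N -ℤ (1ℤ +ℤ d)))
    factor = solve-∀

  [N-4]²-[N-2d]² : (+ N -ℤ + 4) *ℤ (+ N -ℤ + 4) -ℤ w *ℤ w ≡ + 4 *ℤ ((+ d -ℤ + 2) *ℤ (+ N -ℤ (+ 2 +ℤ + d)))
  [N-4]²-[N-2d]² = factor (+ N) (+ d)
    where
    factor : ∀ N d → (N -ℤ + 4) *ℤ (N -ℤ + 4) -ℤ (N -ℤ + 2 *ℤ d) *ℤ (N -ℤ + 2 *ℤ d)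
                       ≡ + 4 *ℤ ((d -ℤ + 2) *ℤ (N -ℤ (+ 2 +ℤ d)))
    factor = solve-∀

  4≤[N-2d]² : ∀ a → N ≡ 2 * a → d ≢ a → + 4 ≤ℤ w *ℤ w
  4≤[N-2d]² a N≡2a d≢a = ℤₚ.0≤i-j⇒j≤i (subst (0ℤ ≤ℤ_) (sym w²-4)
    (0≤i*j {+ 4} (+≤+ z≤n) (ℤₚ.i≤j⇒0≤j-i (1≤i*i (+ a -ℤ + d) a-d≢0))))
    where
    factor : ∀ a d → (+ 2 *ℤ a -ℤ + 2 *ℤ d) *ℤ (+ 2 *ℤ a -ℤ + 2 *ℤ d) -ℤ + 4 ≡ + 4 *ℤ ((a -ℤ d) *ℤ (a -ℤ d) -ℤ 1ℤ)
    factor = solve-∀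
    w²-4 : w *ℤ w -ℤ + 4 ≡ + 4 *ℤ ((+ a -ℤ + d) *ℤ (+ a -ℤ + d) -ℤ 1ℤ)
    w²-4 = trans (cong (λ n → (n -ℤ + 2 *ℤ + d) *ℤ (n -ℤ + 2 *ℤ + d) -ℤ + 4) (trans (cong +_ N≡2a) (ℤₚ.pos-* 2 a)))
                 (factor (+ a) (+ d))
    a-d≢0 : + a -ℤ + d ≢ 0ℤ
    a-d≢0 a-d≡0 = d≢a (sym (ℤₚ.+-injective (ℤₚ.i-j≡0⇒i≡j (+ a) (+ d) a-d≡0)))

  [N-2d]²≤[N-2]² : 1 ≤ d → d < N → w *ℤ w ≤ℤ (+ N -ℤ + 2) *ℤ (+ N -ℤ + 2)
  [N-2d]²≤[N-2]² 1≤d d<N = ℤₚ.0≤i-j⇒j≤i (subst (0ℤ ≤ℤ_) (sym [N-2]²-[N-2d]²)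
    (0≤i*j {+ 4} (+≤+ z≤n) (0≤i*j (ℤₚ.i≤j⇒0≤j-i (+≤+ 1≤d))
                            (subst (λ t → 0ℤ ≤ℤ + N -ℤ t) (ℤₚ.pos-+ 1 d) (ℤₚ.i≤j⇒0≤j-i (+≤+ d<N))))))

  [N-2d]²≤[N-4]² : 2 ≤ d → 2 + d ≤ N → w *ℤ w ≤ℤ (+ N -ℤ + 4) *ℤ (+ N -ℤ + 4)
  [N-2d]²≤[N-4]² 2≤d 2+d≤N = ℤₚ.0≤i-j⇒j≤i (subst (0ℤ ≤ℤ_) (sym [N-4]²-[N-2d]²)
    (0≤i*j {+ 4} (+≤+ z≤n) (0≤i*j (ℤₚ.i≤j⇒0≤j-i (+≤+ 2≤d))
                            (subst (λ t → 0ℤ ≤ℤ + N -ℤ t) (ℤₚ.pos-+ 2 d) (ℤₚ.i≤j⇒0≤j-i (+≤+ 2+d≤N))))))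

  [N-2d]²≡[N-2]²⇔ : (w *ℤ w ≡ (+ N -ℤ + 2) *ℤ (+ N -ℤ + 2)) ⇔ (d ≡ 1 ⊎ suc d ≡ N)
  [N-2d]²≡[N-2]²⇔ = mk⇔ extremal (λ d∈ → sym (ℤₚ.i-j≡0⇒i≡j _ _ (trans [N-2]²-[N-2d]² (gap≡0 d∈))))
    where
    extremal : w *ℤ w ≡ (+ N -ℤ + 2) *ℤ (+ N -ℤ + 2) → d ≡ 1 ⊎ suc d ≡ N
    extremal w²≡ with ℤₚ.i*j≡0⇒i≡0∨j≡0 (+ 4) (trans (sym [N-2]²-[N-2d]²) (ℤₚ.i≡j⇒i-j≡0 (sym w²≡)))
    ... | inj₁ ()
    ... | inj₂ gap≡0 with ℤₚ.i*j≡0⇒i≡0∨j≡0 (+ d -ℤ 1ℤ) gap≡0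
    ...   | inj₁ d-1≡0   = inj₁ (ℤₚ.+-injective (ℤₚ.i-j≡0⇒i≡j (+ d) 1ℤ d-1≡0))
    ...   | inj₂ N-1-d≡0 = inj₂ (ℤₚ.+-injective (trans (ℤₚ.pos-+ 1 d) (sym (ℤₚ.i-j≡0⇒i≡j (+ N) (1ℤ +ℤ + d) N-1-d≡0))))
    gap≡0 : d ≡ 1 ⊎ suc d ≡ N → + 4 *ℤ ((+ d -ℤ 1ℤ) *ℤ (+ N -ℤ (1ℤ +ℤ + d))) ≡ 0ℤ
    gap≡0 (inj₁ refl) = refl
    gap≡0 (inj₂ refl) = begin
      + 4 *ℤ ((+ d -ℤ 1ℤ) *ℤ (+ suc d -ℤ (1ℤ +ℤ + d))) ≡⟨ cong (λ t → + 4 *ℤ ((+ d -ℤ 1ℤ) *ℤ t)) (ℤₚ.i≡j⇒i-j≡0 (ℤₚ.pos-+ 1 d)) ⟩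
      + 4 *ℤ ((+ d -ℤ 1ℤ) *ℤ 0ℤ)                       ≡⟨ cong (+ 4 *ℤ_) (ℤₚ.*-zeroʳ (+ d -ℤ 1ℤ)) ⟩
      0ℤ                                              ∎

module Spectrum {n} (g : Poly n) where

  N : ℕ
  N = 2 ^ n

  autocorrelation-g : Point n → ℤ
  autocorrelation-g a = Σℤ n (λ x → sgn (eval g (x ⊕ a) xor eval g x))

  S : ℤ
  S = Σℤ n (λ a → autocorrelation-g a *ℤ autocorrelation-g a)

  W : Vec Bool n → ℤ
  W = walsh (sgn ∘ eval g)

  V : Vec Bool n → ℤ
  V u = W u *ℤ W u

  d : Vec Bool n → ℕ
  d u = ∣ (λ x → eval g x xor dot u x) ∣

  Extremal : Vec Bool n → Set
  Extremal u = d u ≡ 1 ⊎ suc (d u) ≡ N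

  DistanceOneFromAffine : Set
  DistanceOneFromAffine = ∃ λ (h : Poly n) → deg h ≤ 1 × ∣ (λ x → eval g x xor eval h x) ∣ ≡ 1

  instance
    N-positive : Positive (+ N)
    N-positive = positive (+<+ (ℕₚ.m^n>0 2 n))

  W≡N-2d : ∀ u → W u ≡ + N -ℤ + 2 *ℤ + d u
  W≡N-2d u = begin
    W u                                              ≡⟨ ∑-cong (allPoints n) (λ x → sgn-xor (eval g x) (dot u x)) ⟨
    ∑ (λ x → sgn (eval g x xor dot u x)) (allPoints n) ≡⟨ ∑-sgn (λ x → eval g x xor dot u x) (allPoints n) ⟩
    + length (allPoints n) -ℤ + 2 *ℤ + d u           ≡⟨ cong (λ l → + l -ℤ + 2 *ℤ + d u) (length-allPoints n) ⟩
    + N -ℤ + 2 *ℤ + d u                              ∎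

  Σℤ-1 : Σℤ n (λ _ → 1ℤ) ≡ + N
  Σℤ-1 = trans (∑-const 1ℤ (allPoints n)) (trans (ℤₚ.*-identityˡ _) (cong +_ (length-allPoints n)))

  parseval : Σℤ n V ≡ + N *ℤ + N
  parseval = trans (plancherel n (sgn ∘ eval g) (sgn ∘ eval g))
                   (cong (+ N *ℤ_) (trans (∑-cong (allPoints n) (sgn*sgn≡1 ∘ eval g)) Σℤ-1))

  ΣV² : Σℤ n (λ u → V u *ℤ V u) ≡ + N *ℤ S
  ΣV² = trans (∑-cong (allPoints n) (λ u → cong₂ _*ℤ_ (V≡walsh u) (V≡walsh u)))
              (plancherel n autocorrelation-g autocorrelation-g)
    where
    V≡walsh : ∀ u → V u ≡ walsh autocorrelation-g u
    V≡walsh u = trans (walsh²≡walsh-autocorrelation n (sgn ∘ eval g) u)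
      (∑-cong (allPoints n) (λ a → cong (_*ℤ χ u a)
        (∑-cong (allPoints n) (λ x → sym (sgn-xor (eval g (x ⊕ a)) (eval g x))))))

  Σ-quadratic : ∀ α β γ → Σℤ n (λ u → α *ℤ (V u *ℤ V u) +ℤ β *ℤ V u +ℤ γ)
                            ≡ α *ℤ (+ N *ℤ S) +ℤ β *ℤ (+ N *ℤ + N) +ℤ γ *ℤ + N
  Σ-quadratic α β γ = begin
    Σℤ n (λ u → α *ℤ (V u *ℤ V u) +ℤ β *ℤ V u +ℤ γ)
      ≡⟨ ∑-quadratic V α β γ (allPoints n) ⟩
    α *ℤ Σℤ n (λ u → V u *ℤ V u) +ℤ β *ℤ Σℤ n V +ℤ γ *ℤ + length (allPoints n)
      ≡⟨ cong₂ (λ s l → α *ℤ s +ℤ β *ℤ Σℤ n V +ℤ γ *ℤ + l) ΣV² (length-allPoints n) ⟩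
    α *ℤ (+ N *ℤ S) +ℤ β *ℤ Σℤ n V +ℤ γ *ℤ + N
      ≡⟨ cong (λ v → α *ℤ (+ N *ℤ S) +ℤ β *ℤ v +ℤ γ *ℤ + N) parseval ⟩
    α *ℤ (+ N *ℤ S) +ℤ β *ℤ (+ N *ℤ + N) +ℤ γ *ℤ + N ∎

  R B B′ : ℤ
  R  = + N *ℤ + N +ℤ (+ N -ℤ 1ℤ) *ℤ ((+ N -ℤ + 4) *ℤ (+ N -ℤ + 4))
  B  = (+ N -ℤ + 2) *ℤ (+ N -ℤ + 2)
  B′ = (+ N -ℤ + 4) *ℤ (+ N -ℤ + 4)

  N*-cancel-≤ : ∀ x y → 0ℤ ≤ℤ + N *ℤ x -ℤ + N *ℤ y → y ≤ℤ x
  N*-cancel-≤ x y 0≤Nx-Ny = ℤₚ.*-cancelˡ-≤-pos y x (+ N) (ℤₚ.0≤i-j⇒j≤i 0≤Nx-Ny)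

  slack : Vec Bool n → ℤ
  slack u = (V u -ℤ + 4) *ℤ (B -ℤ V u)

  Σslack : Σℤ n slack ≡ + N *ℤ R -ℤ + N *ℤ S
  Σslack = begin
    Σℤ n slack
      ≡⟨ ∑-cong (allPoints n) (λ u → expand (V u) B) ⟩
    Σℤ n (λ u → -1ℤ *ℤ (V u *ℤ V u) +ℤ (B +ℤ + 4) *ℤ V u +ℤ - (+ 4 *ℤ B))
      ≡⟨ Σ-quadratic -1ℤ (B +ℤ + 4) (- (+ 4 *ℤ B)) ⟩
    -1ℤ *ℤ (+ N *ℤ S) +ℤ (B +ℤ + 4) *ℤ (+ N *ℤ + N) +ℤ - (+ 4 *ℤ B) *ℤ + N
      ≡⟨ identity (+ N) S ⟩
    + N *ℤ R -ℤ + N *ℤ S ∎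
    where
    expand : ∀ v b → (v -ℤ + 4) *ℤ (b -ℤ v) ≡ -1ℤ *ℤ (v *ℤ v) +ℤ (b +ℤ + 4) *ℤ v +ℤ - (+ 4 *ℤ b)
    expand = solve-∀
    identity : ∀ N S →
      -1ℤ *ℤ (N *ℤ S) +ℤ ((N -ℤ + 2) *ℤ (N -ℤ + 2) +ℤ + 4) *ℤ (N *ℤ N) +ℤ - (+ 4 *ℤ ((N -ℤ + 2) *ℤ (N -ℤ + 2))) *ℤ N
        ≡ N *ℤ (N *ℤ N +ℤ (N -ℤ 1ℤ) *ℤ ((N -ℤ + 4) *ℤ (N -ℤ + 4))) -ℤ N *ℤ S
    identity = solve-∀

  S≤R : (∀ u → 0ℤ ≤ℤ slack u) → S ≤ℤ R
  S≤R 0≤slack = N*-cancel-≤ R S (subst (0ℤ ≤ℤ_) Σslack (∑-nonNeg (allPoints n) 0≤slack))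

  S≡R⇒slack≡0 : (∀ u → 0ℤ ≤ℤ slack u) → S ≡ R → ∀ u → slack u ≡ 0ℤ
  S≡R⇒slack≡0 0≤slack S≡R u = ∑≡0⇒≡0 (∈-allPoints u) 0≤slack (begin
    Σℤ n slack             ≡⟨ Σslack ⟩
    + N *ℤ R -ℤ + N *ℤ S   ≡⟨ cong (λ s → + N *ℤ R -ℤ + N *ℤ s) S≡R ⟩
    + N *ℤ R -ℤ + N *ℤ R   ≡⟨ ℤₚ.+-inverseʳ (+ N *ℤ R) ⟩
    0ℤ                     ∎)

  V≡B⇒R≤S : ∀ u → V u ≡ B → R ≤ℤ S
  V≡B⇒R≤S u V≡B = N*-cancel-≤ S R (subst (0ℤ ≤ℤ_) gap
    (ℤₚ.i≤j⇒0≤j-i (∈⇒≤∑ {f = λ v → (V v -ℤ + 4) *ℤ (V v -ℤ + 4)} (∈-allPoints u) (λ v → 0≤i*i (V v -ℤ + 4)))))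
    where
    expand : ∀ v → (v -ℤ + 4) *ℤ (v -ℤ + 4) ≡ 1ℤ *ℤ (v *ℤ v) +ℤ - + 8 *ℤ v +ℤ + 16
    expand = solve-∀
    identity : ∀ N S →
      1ℤ *ℤ (N *ℤ S) +ℤ - + 8 *ℤ (N *ℤ N) +ℤ + 16 *ℤ N -ℤ ((N -ℤ + 2) *ℤ (N -ℤ + 2) -ℤ + 4) *ℤ ((N -ℤ + 2) *ℤ (N -ℤ + 2) -ℤ + 4)
        ≡ N *ℤ S -ℤ N *ℤ (N *ℤ N +ℤ (N -ℤ 1ℤ) *ℤ ((N -ℤ + 4) *ℤ (N -ℤ + 4)))
    identity = solve-∀
    gap : Σℤ n (λ v → (V v -ℤ + 4) *ℤ (V v -ℤ + 4)) -ℤ (V u -ℤ + 4) *ℤ (V u -ℤ + 4) ≡ + N *ℤ S -ℤ + N *ℤ R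
    gap = begin
      Σℤ n (λ v → (V v -ℤ + 4) *ℤ (V v -ℤ + 4)) -ℤ (V u -ℤ + 4) *ℤ (V u -ℤ + 4)
        ≡⟨ cong₂ (λ s t → s -ℤ (t -ℤ + 4) *ℤ (t -ℤ + 4))
                 (trans (∑-cong (allPoints n) (expand ∘ V)) (Σ-quadratic 1ℤ (- + 8) (+ 16))) V≡B ⟩
      1ℤ *ℤ (+ N *ℤ S) +ℤ - + 8 *ℤ (+ N *ℤ + N) +ℤ + 16 *ℤ + N -ℤ (B -ℤ + 4) *ℤ (B -ℤ + 4)
        ≡⟨ identity (+ N) S ⟩
      + N *ℤ S -ℤ + N *ℤ R ∎

  S<R : 2 < N → (∀ u → V u ≤ℤ B′) → S <ℤ R
  S<R 2<N V≤B′ = ℤₚ.≤-<-trans S≤B′N B′N<R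
    where
    expand : ∀ v b → v *ℤ (b -ℤ v) ≡ -1ℤ *ℤ (v *ℤ v) +ℤ b *ℤ v +ℤ 0ℤ
    expand = solve-∀
    identity : ∀ N S b → -1ℤ *ℤ (N *ℤ S) +ℤ b *ℤ (N *ℤ N) +ℤ 0ℤ *ℤ N ≡ N *ℤ (b *ℤ N) -ℤ N *ℤ S
    identity = solve-∀
    S≤B′N : S ≤ℤ B′ *ℤ + N
    S≤B′N = N*-cancel-≤ (B′ *ℤ + N) S (subst (0ℤ ≤ℤ_)
      (trans (∑-cong (allPoints n) (λ u → expand (V u) B′)) (trans (Σ-quadratic -1ℤ B′ 0ℤ) (identity (+ N) S B′)))
      (∑-nonNeg (allPoints n) (λ u → 0≤i*j (0≤i*i (W u)) (ℤₚ.i≤j⇒0≤j-i (V≤B′ u)))))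
    R≡B′N+8[N-2] : ∀ N → N *ℤ N +ℤ (N -ℤ 1ℤ) *ℤ ((N -ℤ + 4) *ℤ (N -ℤ + 4)) ≡ (N -ℤ + 4) *ℤ (N -ℤ + 4) *ℤ N +ℤ + 8 *ℤ (N -ℤ + 2)
    R≡B′N+8[N-2] = solve-∀
    0<8[N-2] : 0ℤ <ℤ + 8 *ℤ (+ N -ℤ + 2)
    0<8[N-2] = ℤₚ.*-monoˡ-<-pos (+ 8) (ℤₚ.+-monoˡ-< (- + 2) (+<+ 2<N))
    B′N<R : B′ *ℤ + N <ℤ R
    B′N<R = subst₂ _<ℤ_ (ℤₚ.+-identityʳ (B′ *ℤ + N)) (sym (R≡B′N+8[N-2] (+ N))) (ℤₚ.+-monoʳ-< (B′ *ℤ + N) 0<8[N-2])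

  slack≡0⇒V≡4⊎V≡B : ∀ u → slack u ≡ 0ℤ → V u ≡ + 4 ⊎ V u ≡ B
  slack≡0⇒V≡4⊎V≡B u slack≡0 = Data.Sum.map (ℤₚ.i-j≡0⇒i≡j (V u) (+ 4)) (sym ∘ ℤₚ.i-j≡0⇒i≡j B (V u))
    (ℤₚ.i*j≡0⇒i≡0∨j≡0 (V u -ℤ + 4) slack≡0)

  V≡4⇒N≡4 : (∀ u → V u ≡ + 4) → + N ≡ + 4
  V≡4⇒N≡4 V≡4 = ℤₚ.*-cancelʳ-≡ (+ N) (+ 4) (+ N) {{ℕₚ.m^n≢0 2 n}} (begin
    + N *ℤ + N                    ≡⟨ parseval ⟨
    Σℤ n V                        ≡⟨ ∑-cong (allPoints n) V≡4 ⟩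
    Σℤ n (λ _ → + 4)              ≡⟨ ∑-const (+ 4) (allPoints n) ⟩
    + 4 *ℤ + length (allPoints n) ≡⟨ cong (λ l → + 4 *ℤ + l) (length-allPoints n) ⟩
    + 4 *ℤ + N                    ∎)

  -- If no Walsh coefficient were extremal, all would equal 4, forcing N = 4 and hence B = 4 after all.
  V∈4B⇒∃V≡B : (∀ u → V u ≡ + 4 ⊎ V u ≡ B) → ∃ λ u → V u ≡ B
  V∈4B⇒∃V≡B V∈4B = search (any? (λ u → V u ℤₚ.≟ B) (allPoints n))
    where
    search : Dec (Any (λ u → V u ≡ B) (allPoints n)) → ∃ λ u → V u ≡ B
    search (yes V≡B-somewhere) = satisfied V≡B-somewhere
    search (no  V≢B-everywhere) = zeros n , trans (V≡4 (zeros n)) (sym B≡4)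
      where
      V≡4 : ∀ u → V u ≡ + 4
      V≡4 u = [ (λ V≡4 → V≡4) , (λ V≡B → contradiction (lose (∈-allPoints u) V≡B) V≢B-everywhere) ]′ (V∈4B u)
      B≡4 : B ≡ + 4
      B≡4 = cong (λ N → (N -ℤ + 2) *ℤ (N -ℤ + 2)) (V≡4⇒N≡4 V≡4)

  d≤N : ∀ u → d u ≤ N
  d≤N u = subst (d u ≤_) (length-allPoints n) (count-≤-length (λ x → eval g x xor dot u x) (allPoints n))

  DistanceOneFromAffine⇔∃Extremal : DistanceOneFromAffine ⇔ (∃ Extremal)
  DistanceOneFromAffine⇔∃Extremal = mk⇔ to from
    where
    ∣not∣≡1⇔ : ∀ u → ∣ not ∘ (λ x → eval g x xor dot u x) ∣ ≡ 1 ⇔ suc (d u) ≡ N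
    ∣not∣≡1⇔ u = mk⇔ (λ c≡1 → trans (cong (_+ d u) (sym c≡1)) (∣not∣+∣∣ n _))
                     (λ 1+d≡N → ℕₚ.+-cancelʳ-≡ (d u) _ 1 (trans (∣not∣+∣∣ n _) (sym 1+d≡N)))
    distance : ∀ u c (h : Poly n) → (∀ x → eval h x ≡ c xor dot u x) → ∣ (λ x → eval g x xor eval h x) ∣ ≡ 1 →
      Extremal u
    distance u false h h≗ dist≡1 = inj₁ (trans (count-cong (allPoints n) (λ x → cong (eval g x xor_) (sym (h≗ x)))) dist≡1)
    distance u true  h h≗ dist≡1 = inj₂ (Equivalence.to (∣not∣≡1⇔ u) (trans (count-cong (allPoints n)
      (λ x → trans (not-distribʳ-xor (eval g x) (dot u x)) (cong (eval g x xor_) (sym (h≗ x))))) dist≡1))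
    to : DistanceOneFromAffine → ∃ Extremal
    to (h , deg≤1 , dist≡1) with deg≤1⇒affine h deg≤1
    ... | u , c , h≗ = u , distance u c h h≗ dist≡1
    from : ∃ Extremal → DistanceOneFromAffine
    from (u , inj₁ d≡1)   = affinePoly u false , deg-affinePoly u false ,
      trans (count-cong (allPoints n) (λ x → cong (eval g x xor_) (eval-affinePoly u false x))) d≡1
    from (u , inj₂ 1+d≡N) = affinePoly u true , deg-affinePoly u true ,
      trans (count-cong (allPoints n) (λ x → trans (cong (eval g x xor_) (eval-affinePoly u true x))
                                                    (sym (not-distribʳ-xor (eval g x) (dot u x)))))
            (Equivalence.from (∣not∣≡1⇔ u) 1+d≡N)

module Main (m : ℕ) (g : Poly (2 + m)) (2≤deg : 2 ≤ deg g) where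

  open Spectrum g

  n : ℕ
  n = 2 + m

  half : ℕ
  half = 2 * 2 ^ m

  2∣half : 2 ∣ half
  2∣half = divides (2 ^ m) (ℕₚ.*-comm 2 (2 ^ m))

  2∣N : 2 ∣ N
  2∣N = divides half (ℕₚ.*-comm 2 half)

  2<N : 2 < N
  2<N = ℕₚ.<-≤-trans (s≤s (s≤s (s≤s z≤n))) (ℕₚ.*-monoʳ-≤ 2 (ℕₚ.*-monoʳ-≤ 2 (ℕₚ.m^n>0 2 m)))

  not-affine : ∀ u c → ¬ (∀ x → eval g x ≡ c xor dot u x)
  not-affine u c g≗affine = contradiction (ℕₚ.≤-trans 2≤deg (affine⇒deg≤1 g u c g≗affine)) λ { (s≤s ()) }

  0<d : ∀ u → 0 < d u
  0<d u = ℕₚ.n≢0⇒n>0 λ d≡0 → not-affine u false λ x →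
    xor-moveʳ (eval g x) (dot u x) false (count≡0⇒false (∈-allPoints x) d≡0)

  d<N : ∀ u → d u < N
  d<N u = ℕₚ.≤∧≢⇒< (d≤N u) λ d≡N → not-affine u true λ x →
    xor-moveʳ (eval g x) (dot u x) true (not-injective (count≡0⇒false (∈-allPoints x) (∣not∣≡0 d≡N)))
    where
    ∣not∣≡0 : d u ≡ N → ∣ not ∘ (λ x → eval g x xor dot u x) ∣ ≡ 0
    ∣not∣≡0 d≡N = ℕₚ.+-cancelʳ-≡ (d u) _ 0 (trans (∣not∣+∣∣ n _) (sym d≡N))

  2∣d⇔2∣∣g∣ : ∀ u → (2 ∣ d u) ⇔ (2 ∣ ∣ eval g ∣)
  2∣d⇔2∣∣g∣ u = 2∣count-xor⇔ (eval g) (dot u) (allPoints n) (2∣∣dot∣ m u)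

  V≡[N-2d]² : ∀ u → V u ≡ (+ N -ℤ + 2 *ℤ + d u) *ℤ (+ N -ℤ + 2 *ℤ + d u)
  V≡[N-2d]² u = cong₂ _*ℤ_ (W≡N-2d u) (W≡N-2d u)

  0≤slack : ¬ (2 ∣ ∣ eval g ∣) → ∀ u → 0ℤ ≤ℤ slack u
  0≤slack ∣g∣-odd u = 0≤i*j (ℤₚ.i≤j⇒0≤j-i 4≤V) (ℤₚ.i≤j⇒0≤j-i V≤B)
    where
    d≢half : d u ≢ half
    d≢half d≡half = ∣g∣-odd (Equivalence.to (2∣d⇔2∣∣g∣ u) (subst (2 ∣_) (sym d≡half) 2∣half))
    4≤V : + 4 ≤ℤ V u
    4≤V = subst (+ 4 ≤ℤ_) (sym (V≡[N-2d]² u)) (4≤[N-2d]² N (d u) half refl d≢half)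
    V≤B : V u ≤ℤ B
    V≤B = subst (_≤ℤ B) (sym (V≡[N-2d]² u)) ([N-2d]²≤[N-2]² N (d u) (0<d u) (d<N u))

  V≤B′ : 2 ∣ ∣ eval g ∣ → ∀ u → V u ≤ℤ B′
  V≤B′ ∣g∣-even u = subst (_≤ℤ B′) (sym (V≡[N-2d]² u))
    ([N-2d]²≤[N-4]² N (d u) (even<even⇒2+≤ (divides 0 refl) 2∣d (0<d u)) (even<even⇒2+≤ 2∣d 2∣N (d<N u)))
    where
    2∣d : 2 ∣ d u
    2∣d = Equivalence.from (2∣d⇔2∣∣g∣ u) ∣g∣-even

  V≡B⇔extremal : ∀ u → (V u ≡ B) ⇔ (Extremal u)
  V≡B⇔extremal u = mk⇔
    (λ V≡B → Equivalence.to ([N-2d]²≡[N-2]²⇔ N (d u)) (trans (sym (V≡[N-2d]² u)) V≡B))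
    (λ extremal → trans (V≡[N-2d]² u) (Equivalence.from ([N-2d]²≡[N-2]²⇔ N (d u)) extremal))

  extremal⇒∣g∣-odd : ∀ u → Extremal u → ¬ (2 ∣ ∣ eval g ∣)
  extremal⇒∣g∣-odd u extremal ∣g∣-even = contradiction (∣1⇒≡1 (2∣1 extremal)) λ ()
    where
    2∣d : 2 ∣ d u
    2∣d = Equivalence.from (2∣d⇔2∣∣g∣ u) ∣g∣-even
    2∣1 : Extremal u → 2 ∣ 1
    2∣1 (inj₁ d≡1)   = subst (2 ∣_) d≡1 2∣d
    2∣1 (inj₂ 1+d≡N) = ∣m+n∣m⇒∣n (subst (2 ∣_) (trans (sym 1+d≡N) (ℕₚ.+-comm 1 (d u))) 2∣N) 2∣d

  theorem : (S ≤ℤ R) × ((S ≡ R) ⇔ DistanceOneFromAffine)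
  theorem = by-parity (2 ∣? ∣ eval g ∣)
    where
    by-parity : Dec (2 ∣ ∣ eval g ∣) → (S ≤ℤ R) × ((S ≡ R) ⇔ DistanceOneFromAffine)
    by-parity (yes ∣g∣-even) = ℤₚ.<⇒≤ S<R′ , mk⇔
      (λ S≡R → contradiction S≡R (ℤₚ.<⇒≢ S<R′))
      (λ close → let (u , extremal) = Equivalence.to DistanceOneFromAffine⇔∃Extremal close
                 in  contradiction ∣g∣-even (extremal⇒∣g∣-odd u extremal))
      where
      S<R′ : S <ℤ R
      S<R′ = S<R 2<N (V≤B′ ∣g∣-even)
    by-parity (no ∣g∣-odd) = S≤R (0≤slack ∣g∣-odd) , mk⇔
      (λ S≡R → let (u , V≡B) = V∈4B⇒∃V≡B (λ u → slack≡0⇒V≡4⊎V≡B u (S≡R⇒slack≡0 (0≤slack ∣g∣-odd) S≡R u))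
               in  Equivalence.from DistanceOneFromAffine⇔∃Extremal (u , Equivalence.to (V≡B⇔extremal u) V≡B))
      (λ close → let (u , extremal) = Equivalence.to DistanceOneFromAffine⇔∃Extremal close
                 in  ℤₚ.≤-antisym (S≤R (0≤slack ∣g∣-odd)) (V≡B⇒R≤S u (Equivalence.from (V≡B⇔extremal u) extremal)))

+[2^[2n]]≡2^n*2^n : ∀ n → + (2 ^ (2 * n)) ≡ + (2 ^ n) *ℤ + (2 ^ n)
+[2^[2n]]≡2^n*2^n n = begin
  + (2 ^ (n + (n + 0)))  ≡⟨ cong (λ k → + (2 ^ (n + k))) (ℕₚ.+-identityʳ n) ⟩
  + (2 ^ (n + n))        ≡⟨ cong +_ (ℕₚ.^-distribˡ-+-* 2 n n) ⟩
  + (2 ^ n * 2 ^ n)      ≡⟨ ℤₚ.pos-* (2 ^ n) (2 ^ n) ⟩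
  + (2 ^ n) *ℤ + (2 ^ n) ∎

lemma7p1 : (n : ℕ) (g : Poly n) → 2 ≤ deg g →
    (Σℤ n (λ a → Σℤ n (λ x → sgn (eval g (x ⊕ a) xor eval g x)) *ℤ Σℤ n (λ x → sgn (eval g (x ⊕ a) xor eval g x)))
      ≤ℤ (+ (2 Data.Nat.^ (2 Data.Nat.* n)) +ℤ ((+ (2 Data.Nat.^ n) -ℤ + 1) *ℤ ((+ (2 Data.Nat.^ n) -ℤ + 4) *ℤ (+ (2 Data.Nat.^ n) -ℤ + 4)))))
    × ((Σℤ n (λ a → Σℤ n (λ x → sgn (eval g (x ⊕ a) xor eval g x)) *ℤ Σℤ n (λ x → sgn (eval g (x ⊕ a) xor eval g x)))
      ≡ (+ (2 Data.Nat.^ (2 Data.Nat.* n)) +ℤ ((+ (2 Data.Nat.^ n) -ℤ + 1) *ℤ ((+ (2 Data.Nat.^ n) -ℤ + 4) *ℤ (+ (2 Data.Nat.^ n) -ℤ + 4)))))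
      ⇔ ∃ (λ (h : Poly n) → deg h ≤ 1 × ∣ (λ x → eval g x xor eval h x) ∣ ≡ 1))
lemma7p1 zero          g 2≤deg = contradiction (ℕₚ.≤-trans 2≤deg (deg≤n g)) λ ()
lemma7p1 (suc zero)    g 2≤deg = contradiction (ℕₚ.≤-trans 2≤deg (deg≤n g)) λ { (s≤s ()) }
lemma7p1 (suc (suc m)) g 2≤deg =
  subst (λ N² → (S ≤ℤ N² +ℤ X) × ((S ≡ N² +ℤ X) ⇔ DistanceOneFromAffine))
        (sym (+[2^[2n]]≡2^n*2^n (2 + m)))
        (Main.theorem m g 2≤deg)
  where
  open Spectrum g using (S; N; DistanceOneFromAffine)
  X : ℤ
  X = (+ N -ℤ 1ℤ) *ℤ ((+ N -ℤ + 4) *ℤ (+ N -ℤ + 4))
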